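{- Let $m > n \ge 1$ be relatively prime integers of opposite parity, and put $A = (m-1)(m^2-n^2) + (m-1)(2mn) - (m^2+n^2)$. Fix a positive integer $b$. Let $y$ be the smallest positive integer such that the closed interval $\left[\frac{b+yn}{m}, \frac{ym}{n}\right]$ contains an integer, and let $x$ be the smallest integer contained in this interval. Then \[ (ym+xn)(m^2-n^2) \le A + (m^2-n^2) + b(2mn). \] -}

module Defs where

open import Data.Nat using (ℕ)
open import Data.Integer using (ℤ; +_; _+_; _-_; _*_; _≤_)
open import Data.Product using (_×_)

A : ℕ → ℕ → ℤ
A m n = (M - + 1) * (M * M - N * N) + (M - + 1) * (+ 2 * M * N) - (M * M + N * N)
  where
  M = + m
  N = + n

-- the integer k lies in the closed interval [(b + y n)/m , y m / n]
-- (denominators m, n are positive, so we clear them)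
InInterval : ℕ → ℕ → ℕ → ℕ → ℤ → Set
InInterval m n b y k = ((+ b + + y * + n) ≤ k * + m) × (k * + n ≤ + y * + m)

{-# OPTIONS --safe #-}
module Submission where

-- Measure how far x sits inside the interval by the slacks u = ym - xn and
-- e = xm - (b + yn), both non-negative.  Minimality of x (x - 1 is not in the
-- interval) gives e < m; minimality of y (neither x nor x - 1 lies in the
-- interval for y - 1) gives u < m, and u < m - n or e < m - n.  The right-hand
-- side minus the left-hand side equals
--   (m - 1 - u)(m² + n²) + 2mn(m - n - 1 - e)
--     = n(m - n)² + (m - n - 1 - u)(m² + n²) + 2mn(m - 1 - e),
-- and one of these two forms is a sum of non-negative terms in either case.

open import Defs
open import Data.Nat using (ℕ; zero; suc; _<_; _≤_; _+_; z≤n; s≤s)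
open import Data.Nat.Properties using (<⇒≤; ≤-refl; ≤-<-trans)
open import Data.Nat.Coprimality using (Coprime)
open import Data.Nat.Divisibility using (_∣_)
open import Data.Integer using (ℤ; +_; -_; -[1+_]; 0ℤ; +≤+; pred)
  renaming (_+_ to _+ℤ_; _*_ to _*ℤ_; _-_ to _-ℤ_; _≤_ to _≤ℤ_; _<_ to _<ℤ_; suc to sucℤ)
open import Data.Integer.Properties
  using (_≤?_; ≰⇒>; <-irrefl; +-mono-≤; i≤j⇒0≤j-i; 0≤i-j⇒j≤i; i<j⇒suc[i]≤j; i≤pred[j]⇒i<j; pos-*)
open import Data.Integer.Tactic.RingSolver using (solve-∀)
open import Data.Product using (∃; _,_)
open import Data.Sum using (_⊎_; inj₁; inj₂)
open import Data.Empty using (⊥-elim)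
open import Relation.Nullary using (¬_; yes; no)
open import Relation.Binary.PropositionalEquality using (_≡_; refl; sym; subst)

0≤i⇒0≤j⇒0≤i*j : ∀ {i j} → 0ℤ ≤ℤ i → 0ℤ ≤ℤ j → 0ℤ ≤ℤ i *ℤ j
0≤i⇒0≤j⇒0≤i*j {+ i} {+ j} _ _ = subst (0ℤ ≤ℤ_) (pos-* i j) (+≤+ z≤n)

0≤i+j : ∀ {i j} → 0ℤ ≤ℤ i → 0ℤ ≤ℤ j → 0ℤ ≤ℤ i +ℤ j
0≤i+j = +-mono-≤

0≤+ : ∀ n → 0ℤ ≤ℤ + n
0≤+ n = +≤+ z≤n

i<j⇒0≤j-suc[i] : ∀ {i j} → i <ℤ j → 0ℤ ≤ℤ j -ℤ sucℤ i
i<j⇒0≤j-suc[i] i<j = i≤j⇒0≤j-i (i<j⇒suc[i]≤j i<j)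

leftGap : ℕ → ℕ → ℕ → ℕ → ℤ → ℤ
leftGap m n b y k = k *ℤ + m -ℤ (+ b +ℤ + y *ℤ + n)

rightGap : ℕ → ℕ → ℕ → ℤ → ℤ
rightGap m n y k = + y *ℤ + m -ℤ k *ℤ + n

module _ (m n b : ℕ) where

  gaps⇒inInterval : ∀ y k → 0ℤ ≤ℤ leftGap m n b y k → 0ℤ ≤ℤ rightGap m n y k →
                    InInterval m n b y k
  gaps⇒inInterval _ _ 0≤l 0≤r = 0≤i-j⇒j≤i 0≤l , 0≤i-j⇒j≤i 0≤r

  leftGap-pred : ∀ y k → leftGap m n b y (pred k) ≡ leftGap m n b y k -ℤ + m
  leftGap-pred y k = identity k (+ m) (+ b) (+ y) (+ n)
    where
    -- pred K is spelled out as - + 1 +ℤ K, which the ring solver can read.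
    identity : ∀ K M B Y N → (- + 1 +ℤ K) *ℤ M -ℤ (B +ℤ Y *ℤ N) ≡ K *ℤ M -ℤ (B +ℤ Y *ℤ N) -ℤ M
    identity = solve-∀

  rightGap-pred : ∀ y k → rightGap m n y (pred k) ≡ rightGap m n y k +ℤ + n
  rightGap-pred y k = identity k (+ m) (+ y) (+ n)
    where
    identity : ∀ K M Y N → Y *ℤ M -ℤ (- + 1 +ℤ K) *ℤ N ≡ Y *ℤ M -ℤ K *ℤ N +ℤ N
    identity = solve-∀

  leftGap-suc : ∀ y k → leftGap m n b y k ≡ leftGap m n b (suc y) k +ℤ + n
  leftGap-suc y k = identity k (+ m) (+ b) (+ y) (+ n)
    where
    identity : ∀ K M B Y N → K *ℤ M -ℤ (B +ℤ Y *ℤ N) ≡ K *ℤ M -ℤ (B +ℤ (+ 1 +ℤ Y) *ℤ N) +ℤ N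
    identity = solve-∀

  rightGap-suc : ∀ y k → rightGap m n y k ≡ rightGap m n (suc y) k -ℤ + m
  rightGap-suc y k = identity k (+ m) (+ y) (+ n)
    where
    identity : ∀ K M Y N → Y *ℤ M -ℤ K *ℤ N ≡ (+ 1 +ℤ Y) *ℤ M -ℤ K *ℤ N -ℤ M
    identity = solve-∀

  leftGap-suc-pred : ∀ y k → leftGap m n b y (pred k) ≡ leftGap m n b (suc y) k -ℤ (+ m -ℤ + n)
  leftGap-suc-pred y k = identity k (+ m) (+ b) (+ y) (+ n)
    where
    identity : ∀ K M B Y N → (- + 1 +ℤ K) *ℤ M -ℤ (B +ℤ Y *ℤ N)
                           ≡ K *ℤ M -ℤ (B +ℤ (+ 1 +ℤ Y) *ℤ N) -ℤ (M -ℤ N)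
    identity = solve-∀

  rightGap-suc-pred : ∀ y k → rightGap m n y (pred k) ≡ rightGap m n (suc y) k -ℤ (+ m -ℤ + n)
  rightGap-suc-pred y k = identity k (+ m) (+ y) (+ n)
    where
    identity : ∀ K M Y N → Y *ℤ M -ℤ (- + 1 +ℤ K) *ℤ N ≡ (+ 1 +ℤ Y) *ℤ M -ℤ K *ℤ N -ℤ (M -ℤ N)
    identity = solve-∀

  leftGap<m : ∀ y x → InInterval m n b y x → (∀ k → InInterval m n b y k → x ≤ℤ k) →
              leftGap m n b y x <ℤ + m
  leftGap<m y x (l , r) x-minimal = ≰⇒> λ m≤gap →
    let 0≤l′ = subst (0ℤ ≤ℤ_) (sym (leftGap-pred y x)) (i≤j⇒0≤j-i m≤gap)
        0≤r′ = subst (0ℤ ≤ℤ_) (sym (rightGap-pred y x)) (0≤i+j (i≤j⇒0≤j-i r) (0≤+ n))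
    in <-irrefl refl (i≤pred[j]⇒i<j (x-minimal (pred x) (gaps⇒inInterval y (pred x) 0≤l′ 0≤r′)))

  rightGap<m : ∀ y x → ¬ ∃ (InInterval m n b y) → InInterval m n b (suc y) x →
               rightGap m n (suc y) x <ℤ + m
  rightGap<m y x empty (l , r) = ≰⇒> λ m≤gap →
    let 0≤l′ = subst (0ℤ ≤ℤ_) (sym (leftGap-suc y x)) (0≤i+j (i≤j⇒0≤j-i l) (0≤+ n))
        0≤r′ = subst (0ℤ ≤ℤ_) (sym (rightGap-suc y x)) (i≤j⇒0≤j-i m≤gap)
    in empty (x , gaps⇒inInterval y x 0≤l′ 0≤r′)

  gap<m-n : ∀ y x → ¬ ∃ (InInterval m n b y) →
            rightGap m n (suc y) x <ℤ + m -ℤ + n ⊎ leftGap m n b (suc y) x <ℤ + m -ℤ + n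
  gap<m-n y x empty with + m -ℤ + n ≤? rightGap m n (suc y) x | + m -ℤ + n ≤? leftGap m n b (suc y) x
  ... | no  d≰r | _       = inj₁ (≰⇒> d≰r)
  ... | yes _   | no  d≰l = inj₂ (≰⇒> d≰l)
  ... | yes d≤r | yes d≤l = ⊥-elim (empty (pred x , gaps⇒inInterval y (pred x) 0≤l′ 0≤r′))
    where
    0≤l′ = subst (0ℤ ≤ℤ_) (sym (leftGap-suc-pred y x)) (i≤j⇒0≤j-i d≤l)
    0≤r′ = subst (0ℤ ≤ℤ_) (sym (rightGap-suc-pred y x)) (i≤j⇒0≤j-i d≤r)


no-integer-at-0 : ∀ m n b → 1 ≤ m → 1 ≤ n → 1 ≤ b → ∀ k → ¬ InInterval m n b 0 k
no-integer-at-0 (suc m) (suc n) (suc b) _ _ _ (+ zero)  (+≤+ () , _)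
no-integer-at-0 (suc m) (suc n) (suc b) _ _ _ (+ suc k) (_ , +≤+ ())
no-integer-at-0 (suc m) (suc n) (suc b) _ _ _ -[1+ k ]  (() , _)

no-integer-before-minimal : ∀ m n b y → 1 ≤ m → 1 ≤ n → 1 ≤ b →
  (∀ y′ → 1 ≤ y′ → y′ < suc y → ¬ ∃ (InInterval m n b y′)) → ¬ ∃ (InInterval m n b y)
no-integer-before-minimal m n b zero    1≤m 1≤n 1≤b _ (k , k∈I) = no-integer-at-0 m n b 1≤m 1≤n 1≤b k k∈I
no-integer-before-minimal m n b (suc y) _   _   _   y-minimal = y-minimal (suc y) (s≤s z≤n) ≤-refl

excess : ℕ → ℕ → ℤ → ℤ → ℤ
excess m n u e = (+ m -ℤ sucℤ u) *ℤ (+ m *ℤ + m +ℤ + n *ℤ + n)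
               +ℤ (+ 2 *ℤ + m *ℤ + n) *ℤ ((+ m -ℤ + n) -ℤ sucℤ e)

bound-minus-lhs≡excess : ∀ m n b y x →
  (A m n +ℤ ((+ m *ℤ + m) -ℤ (+ n *ℤ + n))) +ℤ (+ b *ℤ (+ 2 *ℤ + m *ℤ + n))
    -ℤ ((+ y *ℤ + m) +ℤ (x *ℤ + n)) *ℤ ((+ m *ℤ + m) -ℤ (+ n *ℤ + n))
  ≡ excess m n (rightGap m n y x) (leftGap m n b y x)
bound-minus-lhs≡excess m n b y x = identity (+ m) (+ n) (+ b) (+ y) x
  where
  identity : ∀ M N B Y X →
    (((M -ℤ + 1) *ℤ (M *ℤ M -ℤ N *ℤ N) +ℤ (M -ℤ + 1) *ℤ (+ 2 *ℤ M *ℤ N) -ℤ (M *ℤ M +ℤ N *ℤ N))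
      +ℤ (M *ℤ M -ℤ N *ℤ N)) +ℤ B *ℤ (+ 2 *ℤ M *ℤ N)
      -ℤ (Y *ℤ M +ℤ X *ℤ N) *ℤ (M *ℤ M -ℤ N *ℤ N)
    ≡ (M -ℤ (+ 1 +ℤ (Y *ℤ M -ℤ X *ℤ N))) *ℤ (M *ℤ M +ℤ N *ℤ N)
      +ℤ (+ 2 *ℤ M *ℤ N) *ℤ ((M -ℤ N) -ℤ (+ 1 +ℤ (X *ℤ M -ℤ (B +ℤ Y *ℤ N))))
  identity = solve-∀

excess-rearranged : ∀ m n u e → excess m n u e ≡
  + n *ℤ ((+ m -ℤ + n) *ℤ (+ m -ℤ + n)) +ℤ ((+ m -ℤ + n) -ℤ sucℤ u) *ℤ (+ m *ℤ + m +ℤ + n *ℤ + n)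
    +ℤ (+ 2 *ℤ + m *ℤ + n) *ℤ (+ m -ℤ sucℤ e)
excess-rearranged m n u e = identity (+ m) (+ n) u e
  where
  identity : ∀ M N U E →
    (M -ℤ (+ 1 +ℤ U)) *ℤ (M *ℤ M +ℤ N *ℤ N) +ℤ (+ 2 *ℤ M *ℤ N) *ℤ ((M -ℤ N) -ℤ (+ 1 +ℤ E))
    ≡ N *ℤ ((M -ℤ N) *ℤ (M -ℤ N)) +ℤ ((M -ℤ N) -ℤ (+ 1 +ℤ U)) *ℤ (M *ℤ M +ℤ N *ℤ N)
      +ℤ (+ 2 *ℤ M *ℤ N) *ℤ (M -ℤ (+ 1 +ℤ E))
  identity = solve-∀

0≤m²+n² : ∀ m n → 0ℤ ≤ℤ + m *ℤ + m +ℤ + n *ℤ + n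
0≤m²+n² m n = 0≤i+j (0≤i⇒0≤j⇒0≤i*j (0≤+ m) (0≤+ m)) (0≤i⇒0≤j⇒0≤i*j (0≤+ n) (0≤+ n))

0≤2mn : ∀ m n → 0ℤ ≤ℤ + 2 *ℤ + m *ℤ + n
0≤2mn m n = 0≤i⇒0≤j⇒0≤i*j (0≤i⇒0≤j⇒0≤i*j (0≤+ 2) (0≤+ m)) (0≤+ n)

excess-nonNeg : ∀ {m n u e} → n ≤ m → u <ℤ + m → e <ℤ + m →
  u <ℤ + m -ℤ + n ⊎ e <ℤ + m -ℤ + n → 0ℤ ≤ℤ excess m n u e
excess-nonNeg {m} {n} {u} {e} n≤m u<m e<m (inj₁ u<m-n) =
  subst (0ℤ ≤ℤ_) (sym (excess-rearranged m n u e))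
    (0≤i+j (0≤i+j (0≤i⇒0≤j⇒0≤i*j (0≤+ n) (0≤i⇒0≤j⇒0≤i*j 0≤m-n 0≤m-n))
                  (0≤i⇒0≤j⇒0≤i*j (i<j⇒0≤j-suc[i] u<m-n) (0≤m²+n² m n)))
           (0≤i⇒0≤j⇒0≤i*j (0≤2mn m n) (i<j⇒0≤j-suc[i] e<m)))
  where
  0≤m-n = i≤j⇒0≤j-i (+≤+ n≤m)
excess-nonNeg {m} {n} _ u<m _ (inj₂ e<m-n) =
  0≤i+j (0≤i⇒0≤j⇒0≤i*j (i<j⇒0≤j-suc[i] u<m) (0≤m²+n² m n))
        (0≤i⇒0≤j⇒0≤i*j (0≤2mn m n) (i<j⇒0≤j-suc[i] e<m-n))

mainTheorem2 : (m n b y : ℕ) (x : ℤ) →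
    1 ≤ n → n < m → Coprime m n → ¬ (2 ∣ (m + n)) → 1 ≤ b →
    1 ≤ y → ∃ (λ k → InInterval m n b y k) →
    (∀ y′ → 1 ≤ y′ → y′ < y → ¬ ∃ (λ k → InInterval m n b y′ k)) →
    InInterval m n b y x → (∀ k → InInterval m n b y k → x ≤ℤ k) →
    ((+ y *ℤ + m) +ℤ (x *ℤ + n)) *ℤ ((+ m *ℤ + m) -ℤ (+ n *ℤ + n))
      ≤ℤ (A m n +ℤ ((+ m *ℤ + m) -ℤ (+ n *ℤ + n))) +ℤ (+ b *ℤ (+ 2 *ℤ + m *ℤ + n))
mainTheorem2 _ _ _ zero    _ _   _   _ _ _   () _ _ _ _
mainTheorem2 m n b (suc y) x 1≤n n<m _ _ 1≤b _ _ y-minimal x∈I x-minimal =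
  0≤i-j⇒j≤i (subst (0ℤ ≤ℤ_) (sym (bound-minus-lhs≡excess m n b (suc y) x))
    (excess-nonNeg (<⇒≤ n<m) (rightGap<m m n b y x empty x∈I) (leftGap<m m n b (suc y) x x∈I x-minimal)
                   (gap<m-n m n b y x empty)))
  where
  empty : ¬ ∃ (InInterval m n b y)
  empty = no-integer-before-minimal m n b y (<⇒≤ (≤-<-trans 1≤n n<m)) 1≤n 1≤b y-minimal
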